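{- Let $\mathcal{C}$ be a $(v_2)$ configuration. Then $\mathcal{C}$ is a disjoint union $\mathcal{C}=\bigcup_{i=1}^t C_{n_i}$ of polygons $C_{n_i}$ with $n_i>2$ for all $1\le i\le t$. Moreover, for every field $\mathbf F$, \[ wcdim(Levi_{\mathcal{C}},\mathbf F)=\sum_{i=1}^t wcdim(C_{2n_i},\mathbf F), \] where $C_{2n_i}$ denotes the cycle graph on $2n_i$ vertices.
   Context: A configuration is an incidence structure consisting of a set of points and a set of lines together with an incidence relation between points and lines, such that any two distinct points are incident with at most one common line and any two distinct lines are incident with at most one common point. A $(v_2)$ configuration is a configuration with exactly $v\ge 4$ points and exactly $v$ lines in which every line is incident with exactly $2$ points and every point is incident with exactly $2$ lines. A polygon $C_n$ (as a configuration) has $n$ points $P_1,\dots,P_n$ and $n$ lines $\ell_1,\dots,\ell_n$ with $\ell_j$ incident exactly with $P_j$ and $P_{j+1}$ (indices mod $n$); a disjoint union of configurations has as points and lines the disjoint unions of those of the pieces, with no incidences between different pieces. The Levi graph $Levi_{\mathcal{C}}$ is the simple bipartite graph on points and lines with $P$ adjacent to $\ell$ iff $P$ is incident with $\ell$. For a graph $G$ and field $\mathbf F$, a weighting $f:V(G)\to\mathbf F$ is well-covered if $\sum_{x\in M}f(x)$ is the same for every maximal independent set $M$ of $G$; $wcdim(G,\mathbf F)$ is the dimension of the $\mathbf F$-vector space of well-covered weightings. -}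

module Defs where

open import Level using (Level; _⊔_; suc)
open import Data.Nat as ℕ using (ℕ; zero; _<_; _≤_)
open import Data.Fin using (Fin; toℕ; splitAt)
open import Data.Fin.Properties using ()
open import Data.Bool using (Bool; true; false; if_then_else_)
open import Data.Product using (Σ; _×_; _,_; ∃)
open import Data.Sum using (_⊎_; inj₁; inj₂)
open import Data.Empty using (⊥)
open import Relation.Nullary using (¬_)
open import Relation.Binary.PropositionalEquality using (_≡_)
open import Function.Bundles using (_↔_; _⇔_; Inverse)
open import Algebra.Bundles using (CommutativeRing)

count : ∀ {n} → (Fin n → Bool) → ℕ
count {zero} p = 0
count {ℕ.suc n} p = (if p Data.Fin.zero then 1 else 0) ℕ.+ count (λ i → p (Data.Fin.suc i))

sumℕ : ∀ {t} → (Fin t → ℕ) → ℕ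
sumℕ {zero} d = 0
sumℕ {ℕ.suc t} d = d Data.Fin.zero ℕ.+ sumℕ (λ i → d (Data.Fin.suc i))

record Config (v : ℕ) : Set where
  field
    -- Inc P ℓ ≡ true  iff point P is incident with line ℓ
    Inc : Fin v → Fin v → Bool

record IsV2 {v : ℕ} (C : Config v) : Set where
  open Config C
  field
    v≥4          : 4 ≤ v
    line-2-points : ∀ ℓ → count (λ P → Inc P ℓ) ≡ 2
    point-2-lines : ∀ P → count (λ ℓ → Inc P ℓ) ≡ 2
    points-≤1-line : ∀ P Q → ¬ (P ≡ Q) → ∀ ℓ m →
      Inc P ℓ ≡ true → Inc Q ℓ ≡ true → Inc P m ≡ true → Inc Q m ≡ true → ℓ ≡ m
    lines-≤1-point : ∀ ℓ m → ¬ (ℓ ≡ m) → ∀ P Q →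
      Inc P ℓ ≡ true → Inc P m ≡ true → Inc Q ℓ ≡ true → Inc Q m ≡ true → P ≡ Q

-- Points and lines are both indexed by pairs (i , a) with a : Fin (n i);
-- line ℓ_(i,b) is incident exactly with P_(i,b) and P_(i,b+1 mod n i).

PolyElt : (t : ℕ) → (Fin t → ℕ) → Set
PolyElt t n = Σ (Fin t) (λ i → Fin (n i))

IsNext : ∀ {k} → Fin k → Fin k → Set
IsNext {k} a b = toℕ a ≡ ℕ.suc (toℕ b) ⊎ (toℕ a ≡ 0 × ℕ.suc (toℕ b) ≡ k)

PolyInc : ∀ {t} (n : Fin t → ℕ) → PolyElt t n → PolyElt t n → Set
PolyInc n (i , a) (j , b) = i ≡ j × (toℕ a ≡ toℕ b ⊎ (toℕ a ≡ ℕ.suc (toℕ b) ⊎ (toℕ a ≡ 0 × ℕ.suc (toℕ b) ≡ n j)))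

record IsoPolyUnion {v : ℕ} (C : Config v) (t : ℕ) (n : Fin t → ℕ) : Set where
  open Config C
  field
    onPoints : Fin v ↔ PolyElt t n
    onLines  : Fin v ↔ PolyElt t n
    incidence : ∀ P ℓ →
      (Inc P ℓ ≡ true) ⇔ PolyInc n (Inverse.to onPoints P) (Inverse.to onLines ℓ)

record Graph : Set₁ where
  field
    order : ℕ
    Adj   : Fin order → Fin order → Set

Cycle : ℕ → Graph
Cycle k = record { order = k ; Adj = λ x y → IsNext y x ⊎ IsNext x y }

LeviAdj : ∀ {v} → Config v → Fin v ⊎ Fin v → Fin v ⊎ Fin v → Set
LeviAdj C (inj₁ P) (inj₂ ℓ) = Config.Inc C P ℓ ≡ true
LeviAdj C (inj₂ ℓ) (inj₁ P) = Config.Inc C P ℓ ≡ true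
LeviAdj C (inj₁ _) (inj₁ _) = ⊥
LeviAdj C (inj₂ _) (inj₂ _) = ⊥

Levi : ∀ {v} → Config v → Graph
Levi {v} C = record
  { order = v ℕ.+ v
  ; Adj = λ x y → LeviAdj C (splitAt v x) (splitAt v y) }

module _ (G : Graph) where
  open Graph G

  Independent : (Fin order → Bool) → Set
  Independent S = ∀ x y → S x ≡ true → S y ≡ true → ¬ Adj x y

  MaximalIndependent : (Fin order → Bool) → Set
  MaximalIndependent S = Independent S ×
    (∀ T → Independent T → (∀ x → S x ≡ true → T x ≡ true) →
       ∀ x → T x ≡ true → S x ≡ true)

record Field (c ℓ : Level) : Set (suc (c ⊔ ℓ)) where
  field
    commutativeRing : CommutativeRing c ℓ
  open CommutativeRing commutativeRing public
  field
    0≉1     : ¬ (0# ≈ 1#)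
    inverse : ∀ x → ¬ (x ≈ 0#) → Σ Carrier (λ y → x * y ≈ 1#)

module _ {c ℓ} (F : Field c ℓ) where
  open Field F

  Σ[_] : ∀ {m} → (Fin m → Carrier) → Carrier
  Σ[_] {zero} g = 0#
  Σ[_] {ℕ.suc m} g = g Data.Fin.zero + Σ[_] (λ x → g (Data.Fin.suc x))

  weight : ∀ {m} → (Fin m → Carrier) → (Fin m → Bool) → Carrier
  weight f S = Σ[_] (λ x → if S x then f x else 0#)

  WellCovered : (G : Graph) → (Fin (Graph.order G) → Carrier) → Set ℓ
  WellCovered G f = ∀ M M' → MaximalIndependent G M → MaximalIndependent G M' →
    weight f M ≈ weight f M'

  record WCDim (G : Graph) (d : ℕ) : Set (c ⊔ ℓ) where
    field
      basis        : Fin d → Fin (Graph.order G) → Carrier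
      basis-wc     : ∀ j → WellCovered G (basis j)
      independent  : ∀ (a : Fin d → Carrier) →
        (∀ x → Σ[_] (λ j → a j * basis j x) ≈ 0#) → ∀ j → a j ≈ 0#
      spanning     : ∀ f → WellCovered G f →
        Σ (Fin d → Carrier) (λ a → ∀ x → f x ≈ Σ[_] (λ j → a j * basis j x))

module Submission where

-- Every point of a (v₂) configuration lies on two lines and every line carries two points, so
-- from any point one can walk alternately through points and lines. The first point to recur is
-- the starting one, after at least three steps, and the walk is a polygon closed under incidence;
-- removing it and repeating splits C into polygons C_{n i} with n i > 2. The Levi graph of C_k is
-- the cycle C_{2k}, so Levi C is isomorphic to the disjoint union of the cycles C_{2 n i}.
-- Well-covered weightings are invariant under isomorphism, and on a disjoint union G ⊕ H they are
-- exactly the sums of well-covered weightings of G and of H, so the dimensions add.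

open import Defs

module RelationIsomorphism where

  open import Level using (0ℓ)
  open import Data.Sum using (inj₁; inj₂)
  open import Data.Sum.Relation.Binary.Pointwise as Pointwise using (Pointwise)
  open import Data.Sum.Function.Propositional using (_⊎-cong_)
  open import Function.Bundles using (_↔_; Inverse)
  open import Function.Properties.Inverse using (↔-refl; ↔-sym; ↔-trans)
  open import Relation.Binary.Core using (Rel)
  open import Relation.Binary.PropositionalEquality using (sym; subst₂)

  infix 4 _≅_

  record _≅_ {A B : Set} (R : Rel A 0ℓ) (S : Rel B 0ℓ) : Set where
    field
      bijection : A ↔ B
    private to = Inverse.to bijection
    field
      preserves : ∀ x y → R x y → S (to x) (to y)
      reflects  : ∀ x y → S (to x) (to y) → R x y

  open _≅_ public

  private variable
    A B A′ B′ : Set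
    R S T : Rel A 0ℓ

  ≅-refl : R ≅ R
  ≅-refl = record { bijection = ↔-refl ; preserves = λ _ _ r → r ; reflects = λ _ _ r → r }

  ≅-sym : R ≅ S → S ≅ R
  ≅-sym {S = S} φ = record
    { bijection = ↔-sym (bijection φ)
    ; preserves = λ x y s → reflects φ _ _ (subst₂ S (sym (to∘from x)) (sym (to∘from y)) s)
    ; reflects  = λ x y r → subst₂ S (to∘from x) (to∘from y) (preserves φ _ _ r)
    }
    where to∘from = Inverse.strictlyInverseˡ (bijection φ)

  ≅-trans : R ≅ S → S ≅ T → R ≅ T
  ≅-trans φ ψ = record
    { bijection = ↔-trans (bijection φ) (bijection ψ)
    ; preserves = λ x y r → preserves ψ _ _ (preserves φ x y r)
    ; reflects  = λ x y t → reflects φ x y (reflects ψ _ _ t)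
    }

  _⊎-≅_ : {R : Rel A 0ℓ} {R′ : Rel A′ 0ℓ} {S : Rel B 0ℓ} {S′ : Rel B′ 0ℓ} →
          R ≅ R′ → S ≅ S′ → Pointwise R S ≅ Pointwise R′ S′
  _⊎-≅_ {R = R} {R′} {S} {S′} φ ψ = record
    { bijection = bijection φ ⊎-cong bijection ψ
    ; preserves = λ { _ _ (Pointwise.inj₁ r) → Pointwise.inj₁ (preserves φ _ _ r)
                    ; _ _ (Pointwise.inj₂ s) → Pointwise.inj₂ (preserves ψ _ _ s) }
    ; reflects  = reflects′
    }
    where
    reflects′ : ∀ x y → let open Inverse (bijection φ ⊎-cong bijection ψ) in
                Pointwise R′ S′ (to x) (to y) → Pointwise R S x y
    reflects′ (inj₁ x) (inj₁ y) (Pointwise.inj₁ r) = Pointwise.inj₁ (reflects φ x y r)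
    reflects′ (inj₂ x) (inj₂ y) (Pointwise.inj₂ s) = Pointwise.inj₂ (reflects ψ x y s)

module Graphs where

  open import Data.Nat using (zero; suc; _+_)
  open import Data.Fin using (Fin; zero; suc; splitAt; join; _↑ˡ_; _↑ʳ_)
  open import Data.Fin.Properties using (splitAt-↑ˡ; splitAt-↑ʳ; join-splitAt; +↔⊎)
  open import Data.Vec.Functional using (_++_)
  open import Data.Vec.Functional.Properties using (lookup-++ˡ; lookup-++ʳ)
  open import Data.Bool using (Bool; true)
  open import Data.Product using (Σ; _,_)
  open import Data.Sum using (inj₁; inj₂)
  open import Data.Sum.Relation.Binary.Pointwise as Pointwise using (Pointwise)
  open import Data.Empty using (⊥)
  open import Relation.Binary.PropositionalEquality using (_≡_; sym; trans; subst; subst₂)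
  open import Function.Bundles using (Inverse)
  open RelationIsomorphism
  open Graph

  splitAt-elim : ∀ {ℓ} m {n} (P : Fin (m + n) → Set ℓ) →
    (∀ i → P (i ↑ˡ n)) → (∀ j → P (m ↑ʳ j)) → ∀ x → P x
  splitAt-elim m {n} P left right x = subst P (join-splitAt m n x) (by-cases (splitAt m x))
    where
    by-cases : ∀ s → P (join m n s)
    by-cases (inj₁ i) = left i
    by-cases (inj₂ j) = right j

  _⊕_ : Graph → Graph → Graph
  G ⊕ H = record
    { order = order G + order H
    ; Adj   = λ x y → Pointwise (Adj G) (Adj H) (splitAt (order G) x) (splitAt (order G) y)
    }

  ∅ : Graph
  ∅ = record { order = 0 ; Adj = λ _ _ → ⊥ }

  ⊕-≅-Pointwise : ∀ G H → Adj (G ⊕ H) ≅ Pointwise (Adj G) (Adj H)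
  ⊕-≅-Pointwise G H = record
    { bijection = +↔⊎
    ; preserves = λ _ _ a → a
    ; reflects  = λ _ _ a → a
    }

  HasMaximalIndependentSet : Graph → Set
  HasMaximalIndependentSet G = Σ (Fin (order G) → Bool) (MaximalIndependent G)

  ∅-hasMaximalIndependentSet : HasMaximalIndependentSet ∅
  ∅-hasMaximalIndependentSet = (λ ()) , (λ ()) , (λ _ _ _ ())

  module _ (G H : Graph) where

    private
      m = order G
      n = order H

    adj-↑ˡ : ∀ i j → Adj G i j → Adj (G ⊕ H) (i ↑ˡ n) (j ↑ˡ n)
    adj-↑ˡ i j a = subst₂ (Pointwise (Adj G) (Adj H))
      (sym (splitAt-↑ˡ m i n)) (sym (splitAt-↑ˡ m j n)) (Pointwise.inj₁ a)

    adj-↑ʳ : ∀ i j → Adj H i j → Adj (G ⊕ H) (m ↑ʳ i) (m ↑ʳ j)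
    adj-↑ʳ i j a = subst₂ (Pointwise (Adj G) (Adj H))
      (sym (splitAt-↑ʳ m n i)) (sym (splitAt-↑ʳ m n j)) (Pointwise.inj₂ a)

    independent-↑ˡ : ∀ {S} → Independent (G ⊕ H) S → Independent G (λ i → S (i ↑ˡ n))
    independent-↑ˡ ind i j Si Sj a = ind _ _ Si Sj (adj-↑ˡ i j a)

    independent-↑ʳ : ∀ {S} → Independent (G ⊕ H) S → Independent H (λ i → S (m ↑ʳ i))
    independent-↑ʳ ind i j Si Sj a = ind _ _ Si Sj (adj-↑ʳ i j a)

    independent-++ : ∀ {M N} → Independent G M → Independent H N → Independent (G ⊕ H) (M ++ N)
    independent-++ indM indN x y Mx My with splitAt m x | splitAt m y
    ... | inj₁ i | inj₁ j = λ { (Pointwise.inj₁ a) → indM i j Mx My a }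
    ... | inj₂ i | inj₂ j = λ { (Pointwise.inj₂ a) → indN i j Mx My a }
    ... | inj₁ _ | inj₂ _ = λ ()
    ... | inj₂ _ | inj₁ _ = λ ()

    ++-true-↑ˡ : ∀ (A : Fin m → Bool) (B : Fin n → Bool) i → A i ≡ true → (A ++ B) (i ↑ˡ n) ≡ true
    ++-true-↑ˡ A B i Ai = trans (lookup-++ˡ A B i) Ai

    ++-true-↑ʳ : ∀ (A : Fin m → Bool) (B : Fin n → Bool) i → B i ≡ true → (A ++ B) (m ↑ʳ i) ≡ true
    ++-true-↑ʳ A B i Bi = trans (lookup-++ʳ A B i) Bi

    maximal-++ : ∀ {M N} → MaximalIndependent G M → MaximalIndependent H N →
                 MaximalIndependent (G ⊕ H) (M ++ N)
    maximal-++ {M} {N} (indM , maxM) (indN , maxN) = independent-++ indM indN , maximal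
      where
      maximal : ∀ T → Independent (G ⊕ H) T → (∀ x → (M ++ N) x ≡ true → T x ≡ true) →
                ∀ x → T x ≡ true → (M ++ N) x ≡ true
      maximal T indT M⊆T = splitAt-elim m (λ x → T x ≡ true → (M ++ N) x ≡ true)
        (λ i Ti → ++-true-↑ˡ M N i (maxM _ (independent-↑ˡ indT) (λ j Mj → M⊆T _ (++-true-↑ˡ M N j Mj)) i Ti))
        (λ i Ti → ++-true-↑ʳ M N i (maxN _ (independent-↑ʳ indT) (λ j Nj → M⊆T _ (++-true-↑ʳ M N j Nj)) i Ti))

    maximal-↑ˡ : ∀ {S} → MaximalIndependent (G ⊕ H) S → MaximalIndependent G (λ i → S (i ↑ˡ n))
    maximal-↑ˡ {S} (indS , maxS) = independent-↑ˡ indS , maximal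
      where
      maximal : ∀ T → Independent G T → (∀ i → S (i ↑ˡ n) ≡ true → T i ≡ true) →
                ∀ i → T i ≡ true → S (i ↑ˡ n) ≡ true
      maximal T indT Sˡ⊆T i Ti = maxS (T ++ Sʳ) (independent-++ indT (independent-↑ʳ indS))
        (splitAt-elim m (λ x → S x ≡ true → (T ++ Sʳ) x ≡ true)
          (λ j Sj → ++-true-↑ˡ T Sʳ j (Sˡ⊆T j Sj)) (λ j Sj → ++-true-↑ʳ T Sʳ j Sj))
        (i ↑ˡ n) (++-true-↑ˡ T Sʳ i Ti)
        where Sʳ = λ j → S (m ↑ʳ j)

    maximal-↑ʳ : ∀ {S} → MaximalIndependent (G ⊕ H) S → MaximalIndependent H (λ i → S (m ↑ʳ i))
    maximal-↑ʳ {S} (indS , maxS) = independent-↑ʳ indS , maximal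
      where
      maximal : ∀ T → Independent H T → (∀ i → S (m ↑ʳ i) ≡ true → T i ≡ true) →
                ∀ i → T i ≡ true → S (m ↑ʳ i) ≡ true
      maximal T indT Sʳ⊆T i Ti = maxS (Sˡ ++ T) (independent-++ (independent-↑ˡ indS) indT)
        (splitAt-elim m (λ x → S x ≡ true → (Sˡ ++ T) x ≡ true)
          (λ j Sj → ++-true-↑ˡ Sˡ T j Sj) (λ j Sj → ++-true-↑ʳ Sˡ T j (Sʳ⊆T j Sj)))
        (m ↑ʳ i) (++-true-↑ʳ Sˡ T i Ti)
        where Sˡ = λ j → S (j ↑ˡ n)

  maximal-≅ : ∀ {G H M} (φ : Adj G ≅ Adj H) → MaximalIndependent H M →
              MaximalIndependent G (λ x → M (Inverse.to (bijection φ) x))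
  maximal-≅ {G} {H} {M} φ (indM , maxM) = independent , maximal
    where
    open Inverse (bijection φ)
    independent : Independent G (λ x → M (to x))
    independent x y Mx My a = indM _ _ Mx My (preserves φ x y a)
    maximal : ∀ T → Independent G T → (∀ x → M (to x) ≡ true → T x ≡ true) →
              ∀ x → T x ≡ true → M (to x) ≡ true
    maximal T indT M⊆T x Tx = maxM (λ y → T (from y)) independent-image image-⊇ (to x)
      (subst (λ z → T z ≡ true) (sym (strictlyInverseʳ x)) Tx)
      where
      independent-image : Independent H (λ y → T (from y))
      independent-image y z Ty Tz a = indT _ _ Ty Tz (reflects φ _ _
        (subst₂ (Adj H) (sym (strictlyInverseˡ y)) (sym (strictlyInverseˡ z)) a))
      image-⊇ : ∀ y → M y ≡ true → T (from y) ≡ true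
      image-⊇ y My = M⊆T _ (subst (λ z → M z ≡ true) (sym (strictlyInverseˡ y)) My)

  ⊕-hasMaximalIndependentSet : ∀ G H → HasMaximalIndependentSet G → HasMaximalIndependentSet H →
    HasMaximalIndependentSet (G ⊕ H)
  ⊕-hasMaximalIndependentSet G H (M , maxM) (N , maxN) = M ++ N , maximal-++ G H maxM maxN

  ⋃ : ∀ {t} → (Fin t → Graph) → Graph
  ⋃ {zero} G = ∅
  ⋃ {suc t} G = G zero ⊕ ⋃ (λ i → G (suc i))

  ⋃-hasMaximalIndependentSet : ∀ {t} (G : Fin t → Graph) →
    (∀ i → HasMaximalIndependentSet (G i)) → HasMaximalIndependentSet (⋃ G)
  ⋃-hasMaximalIndependentSet {zero} G _ = ∅-hasMaximalIndependentSet
  ⋃-hasMaximalIndependentSet {suc t} G mis = ⊕-hasMaximalIndependentSet _ _ (mis zero)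
    (⋃-hasMaximalIndependentSet (λ i → G (suc i)) (λ i → mis (suc i)))

module WellCoveredDimension {c ℓ} (F : Field c ℓ) where

  import Data.Nat as ℕ
  open import Data.Fin using (Fin; zero; suc; _↑ˡ_; _↑ʳ_)
  open import Data.Vec.Functional using (_++_)
  open import Data.Vec.Functional.Properties using (lookup-++ˡ; lookup-++ʳ)
  open import Data.Bool using (Bool; true; false; if_then_else_)
  open import Data.Product using (Σ; _,_; proj₁; proj₂)
  open import Function.Bundles using (_↔_; Inverse)
  open import Relation.Binary.PropositionalEquality as ≡ using (_≡_)
  open RelationIsomorphism
  open Graphs
  open Graph using (order; Adj)
  open Field F hiding (zero)
  open import Algebra.Properties.CommutativeMonoid.Sum +-commutativeMonoid
    using (sum; sum-permute)
  open import Algebra.Properties.Group +-group using (∙-cancelˡ; ∙-cancelʳ)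
  open import Relation.Binary.Reasoning.Setoid setoid

  ∑ : ∀ {m} → (Fin m → Carrier) → Carrier
  ∑ = Σ[_] F

  ∑-cong : ∀ {m} {g h : Fin m → Carrier} → (∀ x → g x ≈ h x) → ∑ g ≈ ∑ h
  ∑-cong {ℕ.zero} _ = refl
  ∑-cong {ℕ.suc m} g≈h = +-cong (g≈h zero) (∑-cong (λ x → g≈h (suc x)))

  ∑-zero : ∀ m → ∑ {m} (λ _ → 0#) ≈ 0#
  ∑-zero ℕ.zero = refl
  ∑-zero (ℕ.suc m) = trans (+-identityˡ _) (∑-zero m)

  ∑≡sum : ∀ {m} (g : Fin m → Carrier) → ∑ g ≡ sum g
  ∑≡sum {ℕ.zero} g = ≡.refl
  ∑≡sum {ℕ.suc m} g = ≡.cong (g zero +_) (∑≡sum (λ x → g (suc x)))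

  ∑-permute : ∀ {m k} (π : Fin m ↔ Fin k) (g : Fin k → Carrier) →
              ∑ g ≈ ∑ (λ x → g (Inverse.to π x))
  ∑-permute π g = begin
    ∑ g                            ≡⟨ ∑≡sum g ⟩
    sum g                          ≈⟨ sum-permute g π ⟩
    sum (λ x → g (Inverse.to π x)) ≡⟨ ≡.sym (∑≡sum (λ x → g (Inverse.to π x))) ⟩
    ∑ (λ x → g (Inverse.to π x))   ∎

  ∑-splitAt : ∀ m {n} (g : Fin (m ℕ.+ n) → Carrier) →
              ∑ g ≈ ∑ (λ i → g (i ↑ˡ n)) + ∑ (λ j → g (m ↑ʳ j))
  ∑-splitAt ℕ.zero g = sym (+-identityˡ _)
  ∑-splitAt (ℕ.suc m) g = begin
    g zero + ∑ (λ x → g (suc x))  ≈⟨ +-congˡ (∑-splitAt m (λ x → g (suc x))) ⟩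
    g zero + (_ + _)              ≈⟨ sym (+-assoc _ _ _) ⟩
    _                             ∎

  weight-cong : ∀ {m} {f g : Fin m → Carrier} {S T : Fin m → Bool} →
    (∀ x → f x ≈ g x) → (∀ x → S x ≡ T x) → weight F f S ≈ weight F g T
  weight-cong {f = f} {g} {S} {T} f≈g S≗T = ∑-cong λ x →
    ≡.subst (λ b → (if S x then f x else 0#) ≈ (if b then g x else 0#)) (S≗T x) (select (S x) (f≈g x))
    where
    select : ∀ {y z} b → y ≈ z → (if b then y else 0#) ≈ (if b then z else 0#)
    select true y≈z = y≈z
    select false _ = refl

  weight-splitAt : ∀ m {n} (f : Fin (m ℕ.+ n) → Carrier) S →
    weight F f S ≈ weight F (λ i → f (i ↑ˡ n)) (λ i → S (i ↑ˡ n))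
                 + weight F (λ j → f (m ↑ʳ j)) (λ j → S (m ↑ʳ j))
  weight-splitAt m f S = ∑-splitAt m _

  wellCovered-zero : ∀ G → WellCovered F G (λ _ → 0#)
  wellCovered-zero G M M′ _ _ = trans (weight-zero M) (sym (weight-zero M′))
    where
    weight-zero : ∀ M → weight F (λ _ → 0#) M ≈ 0#
    weight-zero M = trans (∑-cong (λ x → select (M x))) (∑-zero (order G))
      where
      select : ∀ b → (if b then 0# else 0#) ≈ 0#
      select true = refl
      select false = refl

  wellCovered-≅ : ∀ {G H f} (φ : Adj G ≅ Adj H) → WellCovered F G f →
                  WellCovered F H (λ y → f (Inverse.from (bijection φ) y))
  wellCovered-≅ {f = f} φ wc M M′ maxM maxM′ = begin
    weight F (λ y → f (from y)) M             ≈⟨ ∑-permute (bijection φ) _ ⟩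
    weight F (λ x → f (from (to x))) (M ∘to)  ≈⟨ weight-cong from-to (λ _ → ≡.refl) ⟩
    weight F f (M ∘to)                        ≈⟨ wc _ _ (maximal-≅ φ maxM) (maximal-≅ φ maxM′) ⟩
    weight F f (M′ ∘to)                       ≈⟨ weight-cong from-to (λ _ → ≡.refl) ⟨
    weight F (λ x → f (from (to x))) (M′ ∘to) ≈⟨ ∑-permute (bijection φ) _ ⟨
    weight F (λ y → f (from y)) M′            ∎
    where
    open Inverse (bijection φ)
    _∘to : (Fin _ → Bool) → Fin _ → Bool
    (S ∘to) x = S (to x)
    from-to : ∀ x → f (from (to x)) ≈ f x
    from-to x = reflexive (≡.cong f (strictlyInverseʳ x))

  wcdim-≅ : ∀ {G H d} → Adj G ≅ Adj H → WCDim F G d → WCDim F H d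
  wcdim-≅ {G} {H} φ B = record
    { basis       = λ j y → basis j (from y)
    ; basis-wc    = λ j → wellCovered-≅ φ (basis-wc j)
    ; independent = λ a a·b≈0 → independent a λ x →
        trans (∑-cong λ j → *-congˡ (reflexive (≡.cong (basis j) (≡.sym (strictlyInverseʳ x)))))
              (a·b≈0 (to x))
    ; spanning    = λ f wc →
        let (a , f≈a·b) = spanning (λ x → f (to x)) (wellCovered-≅ (≅-sym φ) wc)
        in a , λ y → trans (reflexive (≡.cong f (≡.sym (strictlyInverseˡ y)))) (f≈a·b (from y))
    }
    where
    open WCDim B
    open Inverse (bijection φ)

  wcdim-∅ : WCDim F ∅ 0
  wcdim-∅ = record
    { basis = λ () ; basis-wc = λ () ; independent = λ _ _ () ; spanning = λ _ _ → (λ ()) , (λ ()) }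

  module _ (G H : Graph) where

    private
      m = order G
      n = order H

    weight-++ : ∀ (g : Fin m → Carrier) (h : Fin n → Carrier) S →
      weight F (g ++ h) S ≈ weight F g (λ i → S (i ↑ˡ n)) + weight F h (λ j → S (m ↑ʳ j))
    weight-++ g h S = trans (weight-splitAt m (g ++ h) S)
      (+-cong (weight-cong (λ i → reflexive (lookup-++ˡ g h i)) (λ _ → ≡.refl))
              (weight-cong (λ j → reflexive (lookup-++ʳ g h j)) (λ _ → ≡.refl)))

    weight-on-++ : ∀ f (M : Fin m → Bool) (N : Fin n → Bool) →
      weight F f (M ++ N) ≈ weight F (λ i → f (i ↑ˡ n)) M + weight F (λ j → f (m ↑ʳ j)) N
    weight-on-++ f M N = trans (weight-splitAt m f (M ++ N))
      (+-cong (weight-cong (λ _ → refl) (lookup-++ˡ M N)) (weight-cong (λ _ → refl) (lookup-++ʳ M N)))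

    wellCovered-++ : ∀ {g h} → WellCovered F G g → WellCovered F H h → WellCovered F (G ⊕ H) (g ++ h)
    wellCovered-++ {g} {h} wcg wch M M′ maxM maxM′ = begin
      weight F (g ++ h) M  ≈⟨ weight-++ g h M ⟩
      _ + _                ≈⟨ +-cong (wcg _ _ (maximal-↑ˡ G H maxM) (maximal-↑ˡ G H maxM′))
                                     (wch _ _ (maximal-↑ʳ G H maxM) (maximal-↑ʳ G H maxM′)) ⟩
      _ + _                ≈⟨ weight-++ g h M′ ⟨
      weight F (g ++ h) M′ ∎

    -- Extend maximal independent sets of G by a fixed one of H, whose weight then cancels.
    wellCovered-↑ˡ : ∀ {f} → HasMaximalIndependentSet H → WellCovered F (G ⊕ H) f →
                     WellCovered F G (λ i → f (i ↑ˡ n))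
    wellCovered-↑ˡ {f} (N , maxN) wc M M′ maxM maxM′ = ∙-cancelʳ (weight F _ N) _ _ (begin
      _ + _                ≈⟨ weight-on-++ f M N ⟨
      weight F f (M ++ N)  ≈⟨ wc _ _ (maximal-++ G H maxM maxN) (maximal-++ G H maxM′ maxN) ⟩
      weight F f (M′ ++ N) ≈⟨ weight-on-++ f M′ N ⟩
      _ + _                ∎)

    wellCovered-↑ʳ : ∀ {f} → HasMaximalIndependentSet G → WellCovered F (G ⊕ H) f →
                     WellCovered F H (λ j → f (m ↑ʳ j))
    wellCovered-↑ʳ {f} (M , maxM) wc N N′ maxN maxN′ = ∙-cancelˡ (weight F _ M) _ _ (begin
      _ + _                ≈⟨ weight-on-++ f M N ⟨
      weight F f (M ++ N)  ≈⟨ wc _ _ (maximal-++ G H maxM maxN) (maximal-++ G H maxM maxN′) ⟩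
      weight F f (M ++ N′) ≈⟨ weight-on-++ f M N′ ⟩
      _ + _                ∎)

    wcdim-⊕ : ∀ {d₁ d₂} → HasMaximalIndependentSet G → HasMaximalIndependentSet H →
              WCDim F G d₁ → WCDim F H d₂ → WCDim F (G ⊕ H) (d₁ ℕ.+ d₂)
    wcdim-⊕ {d₁} {d₂} misG misH BG BH = record
      { basis       = basis
      ; basis-wc    = splitAt-elim d₁ (λ j → WellCovered F (G ⊕ H) (basis j))
          (λ k → ≡.subst (WellCovered F (G ⊕ H)) (≡.sym (lookup-++ˡ basisˡ basisʳ k))
                   (wellCovered-++ (BG.basis-wc k) (wellCovered-zero H)))
          (λ k → ≡.subst (WellCovered F (G ⊕ H)) (≡.sym (lookup-++ʳ basisˡ basisʳ k))
                   (wellCovered-++ (wellCovered-zero G) (BH.basis-wc k)))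
      ; independent = λ a a·b≈0 → splitAt-elim d₁ (λ j → a j ≈ 0#)
          (BG.independent _ λ i → trans (sym (combination-↑ˡ a i)) (a·b≈0 _))
          (BH.independent _ λ j → trans (sym (combination-↑ʳ a j)) (a·b≈0 _))
      ; spanning    = spanning
      }
      where
      module BG = WCDim BG
      module BH = WCDim BH

      0⃗ : ∀ {k} → Fin k → Carrier
      0⃗ _ = 0#

      basisˡ : Fin d₁ → Fin (m ℕ.+ n) → Carrier
      basisˡ k = BG.basis k ++ 0⃗
      basisʳ : Fin d₂ → Fin (m ℕ.+ n) → Carrier
      basisʳ k = 0⃗ ++ BH.basis k
      basis : Fin (d₁ ℕ.+ d₂) → Fin (m ℕ.+ n) → Carrier
      basis = basisˡ ++ basisʳ

      combination : (Fin (d₁ ℕ.+ d₂) → Carrier) → Fin (m ℕ.+ n) → Carrier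
      combination a x = ∑ (λ j → a j * basis j x)

      combination-↑ˡ : ∀ a i → combination a (i ↑ˡ n) ≈ ∑ (λ k → a (k ↑ˡ d₂) * BG.basis k i)
      combination-↑ˡ a i = begin
        combination a (i ↑ˡ n)  ≈⟨ ∑-splitAt d₁ _ ⟩
        _ + _                   ≈⟨ +-cong (∑-cong λ k → *-congˡ (reflexive (entry k)))
                                          (∑-cong λ k → trans (*-congˡ (reflexive (zero-entry k))) (zeroʳ _)) ⟩
        _ + ∑ {d₂} 0⃗            ≈⟨ +-congˡ (∑-zero d₂) ⟩
        _ + 0#                  ≈⟨ +-identityʳ _ ⟩
        _                       ∎
        where
        entry : ∀ k → basis (k ↑ˡ d₂) (i ↑ˡ n) ≡ BG.basis k i
        entry k = ≡.trans (≡.cong-app (lookup-++ˡ basisˡ basisʳ k) (i ↑ˡ n)) (lookup-++ˡ (BG.basis k) 0⃗ i)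
        zero-entry : ∀ k → basis (d₁ ↑ʳ k) (i ↑ˡ n) ≡ 0#
        zero-entry k = ≡.trans (≡.cong-app (lookup-++ʳ basisˡ basisʳ k) (i ↑ˡ n))
                               (lookup-++ˡ {m = m} 0⃗ (BH.basis k) i)

      combination-↑ʳ : ∀ a j → combination a (m ↑ʳ j) ≈ ∑ (λ k → a (d₁ ↑ʳ k) * BH.basis k j)
      combination-↑ʳ a j = begin
        combination a (m ↑ʳ j)  ≈⟨ ∑-splitAt d₁ _ ⟩
        _ + _                   ≈⟨ +-cong (∑-cong λ k → trans (*-congˡ (reflexive (zero-entry k))) (zeroʳ _))
                                          (∑-cong λ k → *-congˡ (reflexive (entry k))) ⟩
        ∑ {d₁} 0⃗ + _            ≈⟨ +-congʳ (∑-zero d₁) ⟩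
        0# + _                  ≈⟨ +-identityˡ _ ⟩
        _                       ∎
        where
        entry : ∀ k → basis (d₁ ↑ʳ k) (m ↑ʳ j) ≡ BH.basis k j
        entry k = ≡.trans (≡.cong-app (lookup-++ʳ basisˡ basisʳ k) (m ↑ʳ j))
                          (lookup-++ʳ {m = m} 0⃗ (BH.basis k) j)
        zero-entry : ∀ k → basis (k ↑ˡ d₂) (m ↑ʳ j) ≡ 0#
        zero-entry k = ≡.trans (≡.cong-app (lookup-++ˡ basisˡ basisʳ k) (m ↑ʳ j)) (lookup-++ʳ (BG.basis k) 0⃗ j)

      spanning : ∀ f → WellCovered F (G ⊕ H) f →
                 Σ (Fin (d₁ ℕ.+ d₂) → Carrier) (λ a → ∀ x → f x ≈ combination a x)
      spanning f wc = a , splitAt-elim m (λ x → f x ≈ combination a x)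
          (λ i → trans (proj₂ spanˡ i) (trans (∑-cong λ k → *-congʳ (reflexive (≡.sym (lookup-++ˡ aˡ aʳ k))))
                                              (sym (combination-↑ˡ a i))))
          (λ j → trans (proj₂ spanʳ j) (trans (∑-cong λ k → *-congʳ (reflexive (≡.sym (lookup-++ʳ aˡ aʳ k))))
                                              (sym (combination-↑ʳ a j))))
        where
        spanˡ = BG.spanning _ (wellCovered-↑ˡ misH wc)
        spanʳ = BH.spanning _ (wellCovered-↑ʳ misG wc)
        aˡ = proj₁ spanˡ
        aʳ = proj₁ spanʳ
        a = aˡ ++ aʳ

  wcdim-⋃ : ∀ {t} (G : Fin t → Graph) (d : Fin t → ℕ.ℕ) → (∀ i → HasMaximalIndependentSet (G i)) →
            (∀ i → WCDim F (G i) (d i)) → WCDim F (⋃ G) (sumℕ d)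
  wcdim-⋃ {ℕ.zero} G d _ _ = wcdim-∅
  wcdim-⋃ {ℕ.suc t} G d mis B = wcdim-⊕ (G zero) (⋃ (λ i → G (suc i)))
    (mis zero) (⋃-hasMaximalIndependentSet _ (λ i → mis (suc i)))
    (B zero) (wcdim-⋃ (λ i → G (suc i)) (λ i → d (suc i)) (λ i → mis (suc i)) (λ i → B (suc i)))

module EvenCycles where

  open import Data.Nat using (ℕ; zero; suc; _*_; _<_; _≤_)
  open import Data.Nat.Properties
    using (*-suc; *-monoʳ-<; *-monoʳ-≤; *-cancelˡ-<; *-cancelˡ-≡; even≢odd; <-trans; n<1+n; suc-injective)
  open import Data.Fin using (Fin; toℕ; fromℕ<)
  open import Data.Fin.Properties using (toℕ<n; toℕ-fromℕ<; toℕ-injective)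
  open import Data.Bool using (Bool; true; false)
  open import Data.Product using (Σ; _,_; proj₁; proj₂)
  open import Data.Sum using (_⊎_; inj₁; inj₂)
  open import Data.Empty using (⊥-elim)
  open import Function.Bundles using (_↔_; Inverse; mk↔ₛ′)
  open import Relation.Nullary using (¬_)
  open import Relation.Binary.PropositionalEquality
  open Graphs

  data Parity : ℕ → Set where
    even : ∀ b → Parity (2 * b)
    odd  : ∀ b → Parity (suc (2 * b))

  parity : ∀ a → Parity a
  parity zero = even 0
  parity (suc a) with parity a
  ... | even b = odd b
  ... | odd b = subst Parity (*-suc 2 b) (even (suc b))

  isEven : ℕ → Bool
  isEven a with parity a
  ... | even _ = true
  ... | odd _ = false

  isEven⇒even : ∀ {a} → isEven a ≡ true → Σ ℕ λ b → a ≡ 2 * b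
  isEven⇒even {a} e with parity a
  ... | even b = b , refl

  ¬isEven⇒odd : ∀ {a} → isEven a ≡ false → Σ ℕ λ b → a ≡ suc (2 * b)
  ¬isEven⇒odd {a} e with parity a
  ... | odd b = b , refl

  isEven-2* : ∀ b → isEven (2 * b) ≡ true
  isEven-2* b with isEven (2 * b) in e
  ... | true = refl
  ... | false = let (c , 2b≡1+2c) = ¬isEven⇒odd e in ⊥-elim (even≢odd b c 2b≡1+2c)

  2*-cancel-< : ∀ {b k} → 2 * b < 2 * k → b < k
  2*-cancel-< {b} {k} = *-cancelˡ-< 2 b k

  1+2*-mono-< : ∀ {b k} → b < k → suc (2 * b) < 2 * k
  1+2*-mono-< {b} {k} b<k = subst (_≤ 2 * k) (*-suc 2 b) (*-monoʳ-≤ 2 b<k)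

  -- Points of a k-gon go to the even and lines to the odd vertices of the 2k-cycle.
  interleave : ∀ k → (Fin k ⊎ Fin k) ↔ Fin (2 * k)
  interleave k = mk↔ₛ′ to from to∘from from∘to
    where
    to : Fin k ⊎ Fin k → Fin (2 * k)
    to (inj₁ b) = fromℕ< (*-monoʳ-< 2 (toℕ<n b))
    to (inj₂ b) = fromℕ< (1+2*-mono-< (toℕ<n b))

    halve : ∀ {a} → Parity a → a < 2 * k → Fin k ⊎ Fin k
    halve (even b) lt = inj₁ (fromℕ< (2*-cancel-< {b} lt))
    halve (odd b)  lt = inj₂ (fromℕ< (2*-cancel-< {b} (<-trans (n<1+n (2 * b)) lt)))

    from : Fin (2 * k) → Fin k ⊎ Fin k
    from a = halve (parity (toℕ a)) (toℕ<n a)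

    value : Fin k ⊎ Fin k → ℕ
    value (inj₁ b) = 2 * toℕ b
    value (inj₂ b) = suc (2 * toℕ b)

    toℕ-to : ∀ x → toℕ (to x) ≡ value x
    toℕ-to (inj₁ b) = toℕ-fromℕ< _
    toℕ-to (inj₂ b) = toℕ-fromℕ< _

    toℕ-to-halve : ∀ {a} (p : Parity a) lt → toℕ (to (halve p lt)) ≡ a
    toℕ-to-halve (even b) lt = trans (toℕ-to (halve (even b) lt)) (cong (2 *_) (toℕ-fromℕ< (2*-cancel-< {b} lt)))
    toℕ-to-halve (odd b)  lt = trans (toℕ-to (halve (odd b) lt))
      (cong (λ c → suc (2 * c)) (toℕ-fromℕ< (2*-cancel-< {b} (<-trans (n<1+n (2 * b)) lt))))

    to∘from : ∀ a → to (from a) ≡ a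
    to∘from a = toℕ-injective (toℕ-to-halve (parity (toℕ a)) (toℕ<n a))

    value-injective : ∀ x y → value x ≡ value y → x ≡ y
    value-injective (inj₁ b) (inj₁ c) e = cong inj₁ (toℕ-injective (*-cancelˡ-≡ (toℕ b) (toℕ c) 2 e))
    value-injective (inj₂ b) (inj₂ c) e =
      cong inj₂ (toℕ-injective (*-cancelˡ-≡ (toℕ b) (toℕ c) 2 (suc-injective e)))
    value-injective (inj₁ b) (inj₂ c) e = ⊥-elim (even≢odd (toℕ b) (toℕ c) e)
    value-injective (inj₂ b) (inj₁ c) e = ⊥-elim (even≢odd (toℕ c) (toℕ b) (sym e))

    to-injective : ∀ x y → to x ≡ to y → x ≡ y
    to-injective x y e = value-injective x y (trans (sym (toℕ-to x)) (trans (cong toℕ e) (toℕ-to y)))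

    from∘to : ∀ x → from (to x) ≡ x
    from∘to x = to-injective _ _ (to∘from (to x))

  toℕ-interleave-inj₁ : ∀ {k} (b : Fin k) → toℕ (Inverse.to (interleave k) (inj₁ b)) ≡ 2 * toℕ b
  toℕ-interleave-inj₁ b = toℕ-fromℕ< _

  toℕ-interleave-inj₂ : ∀ {k} (b : Fin k) → toℕ (Inverse.to (interleave k) (inj₂ b)) ≡ suc (2 * toℕ b)
  toℕ-interleave-inj₂ b = toℕ-fromℕ< _

  evens : ∀ {k} → Fin k → Bool
  evens x = isEven (toℕ x)

  evens-not-next : ∀ {K} (x y : Fin K) → isEven K ≡ true → evens x ≡ true → evens y ≡ true →
                   ¬ IsNext x y
  evens-not-next x y evenK ex ey next with isEven⇒even ex | isEven⇒even ey | isEven⇒even evenK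
  ... | p , x≡2p | q , y≡2q | k , K≡2k with next
  ...   | inj₁ x≡1+y = even≢odd p q (trans (sym x≡2p) (trans x≡1+y (cong suc y≡2q)))
  ...   | inj₂ (_ , 1+y≡K) = even≢odd k q (trans (sym K≡2k) (trans (sym 1+y≡K) (cong suc y≡2q)))

  evens-maximal : ∀ k → MaximalIndependent (Cycle (2 * k)) evens
  evens-maximal k = independent , maximal
    where
    independent : Independent (Cycle (2 * k)) evens
    independent x y ex ey (inj₁ next) = evens-not-next y x (isEven-2* k) ey ex next
    independent x y ex ey (inj₂ next) = evens-not-next x y (isEven-2* k) ex ey next

    maximal : ∀ T → Independent (Cycle (2 * k)) T → (∀ x → evens x ≡ true → T x ≡ true) →
              ∀ x → T x ≡ true → evens x ≡ true
    maximal T indT evens⊆T x Tx with evens x in ex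
    ... | true = refl
    ... | false = ⊥-elim (indT w x Tw Tx (inj₁ (inj₁ (trans x≡1+2q (cong suc (sym toℕw≡2q))))))
      where
      q = proj₁ (¬isEven⇒odd ex)
      x≡1+2q = proj₂ (¬isEven⇒odd ex)
      2q<2k : 2 * q < 2 * k
      2q<2k = <-trans (n<1+n (2 * q)) (subst (_< 2 * k) x≡1+2q (toℕ<n x))
      w : Fin (2 * k)
      w = fromℕ< 2q<2k
      toℕw≡2q : toℕ w ≡ 2 * q
      toℕw≡2q = toℕ-fromℕ< 2q<2k
      Tw : T w ≡ true
      Tw = evens⊆T w (trans (cong isEven toℕw≡2q) (isEven-2* q))

  cycle-hasMaximalIndependentSet : ∀ k → HasMaximalIndependentSet (Cycle (2 * k))
  cycle-hasMaximalIndependentSet k = evens , evens-maximal k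



module CyclicIncidence where

  open import Data.Nat using (ℕ; suc; _*_)
  open import Data.Nat.Properties using (*-suc; *-cancelˡ-≡; even≢odd; suc-injective)
  open import Data.Product using (_×_; _,_)
  open import Data.Sum using (_⊎_; inj₁; inj₂)
  open import Relation.Nullary using (¬_)
  open import Relation.Binary.PropositionalEquality

  -- Read on toℕ, Nextℕ is IsNext, CycleAdjℕ is the adjacency of Cycle and PolygonIncℕ that of PolyInc.
  Nextℕ : ℕ → ℕ → ℕ → Set
  Nextℕ K a b = a ≡ suc b ⊎ (a ≡ 0 × suc b ≡ K)

  CycleAdjℕ : ℕ → ℕ → ℕ → Set
  CycleAdjℕ K a b = Nextℕ K b a ⊎ Nextℕ K a b

  PolygonIncℕ : ℕ → ℕ → ℕ → Set
  PolygonIncℕ k a b = a ≡ b ⊎ Nextℕ k a b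

  polygonInc⇒cycleAdj : ∀ k b c → PolygonIncℕ k b c → CycleAdjℕ (2 * k) (2 * b) (suc (2 * c))
  polygonInc⇒cycleAdj k b .b (inj₁ refl) = inj₁ (inj₁ refl)
  polygonInc⇒cycleAdj k .(suc c) c (inj₂ (inj₁ refl)) = inj₂ (inj₁ (*-suc 2 c))
  polygonInc⇒cycleAdj k .0 c (inj₂ (inj₂ (refl , 1+c≡k))) =
    inj₂ (inj₂ (refl , trans (sym (*-suc 2 c)) (cong (2 *_) 1+c≡k)))

  cycleAdj⇒polygonInc : ∀ k b c → CycleAdjℕ (2 * k) (2 * b) (suc (2 * c)) → PolygonIncℕ k b c
  cycleAdj⇒polygonInc k b c (inj₁ (inj₁ e)) = inj₁ (*-cancelˡ-≡ b c 2 (sym (suc-injective e)))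
  cycleAdj⇒polygonInc k b c (inj₂ (inj₁ e)) = inj₂ (inj₁ (*-cancelˡ-≡ b (suc c) 2 (trans e (sym (*-suc 2 c)))))
  cycleAdj⇒polygonInc k b c (inj₂ (inj₂ (2b≡0 , e))) =
    inj₂ (inj₂ (*-cancelˡ-≡ b 0 2 2b≡0 , *-cancelˡ-≡ (suc c) k 2 (trans (*-suc 2 c) e)))

  even-even-nonadjacent : ∀ k b b′ → ¬ CycleAdjℕ (2 * k) (2 * b) (2 * b′)
  even-even-nonadjacent k b b′ (inj₁ (inj₁ e)) = even≢odd b′ b e
  even-even-nonadjacent k b b′ (inj₁ (inj₂ (_ , e))) = even≢odd k b (sym e)
  even-even-nonadjacent k b b′ (inj₂ (inj₁ e)) = even≢odd b b′ e
  even-even-nonadjacent k b b′ (inj₂ (inj₂ (_ , e))) = even≢odd k b′ (sym e)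

  odd-odd-nonadjacent : ∀ K c c′ → ¬ CycleAdjℕ K (suc (2 * c)) (suc (2 * c′))
  odd-odd-nonadjacent K c c′ (inj₁ (inj₁ e)) = even≢odd c′ c (suc-injective e)
  odd-odd-nonadjacent K c c′ (inj₂ (inj₁ e)) = even≢odd c c′ (suc-injective e)


module LeviOfPolygons where

  open import Level using (0ℓ)
  open import Data.Nat using (ℕ; zero; suc; _*_)
  open import Data.Fin using (Fin; zero; suc; toℕ; splitAt)
  open import Data.Fin.Properties using (+↔⊎)
  open import Data.Bool using (true)
  open import Data.Product using (Σ; _,_)
  open import Data.Sum as Sum using (_⊎_; inj₁; inj₂)
  open import Data.Sum.Relation.Binary.Pointwise as Pointwise using (Pointwise)
  open import Data.Sum.Function.Propositional using (_⊎-cong_)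
  open import Data.Empty using (⊥-elim)
  open import Function.Bundles using (_↔_; _⇔_; Inverse; Equivalence; mk↔ₛ′)
  open import Relation.Binary.Core using (Rel)
  open import Relation.Binary.PropositionalEquality
  open RelationIsomorphism
  open Graphs
  open Graph using (order; Adj)
  open EvenCycles
  open CyclicIncidence

  data Bipartite {A B : Set} (I : A → B → Set) : Rel (A ⊎ B) 0ℓ where
    point-line : ∀ {a b} → I a b → Bipartite I (inj₁ a) (inj₂ b)
    line-point : ∀ {a b} → I a b → Bipartite I (inj₂ b) (inj₁ a)

  Levi≅Bipartite : ∀ {v} (C : Config v) → Adj (Levi C) ≅ Bipartite (λ P ℓ → Config.Inc C P ℓ ≡ true)
  Levi≅Bipartite {v} C = record
    { bijection = +↔⊎
    ; preserves = λ x y → to-bipartite (splitAt v x) (splitAt v y)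
    ; reflects  = λ x y → from-bipartite (splitAt v x) (splitAt v y)
    }
    where
    Inc = λ P ℓ → Config.Inc C P ℓ ≡ true
    to-bipartite : ∀ s t → LeviAdj C s t → Bipartite Inc s t
    to-bipartite (inj₁ P) (inj₂ ℓ) inc = point-line inc
    to-bipartite (inj₂ ℓ) (inj₁ P) inc = line-point inc
    from-bipartite : ∀ s t → Bipartite Inc s t → LeviAdj C s t
    from-bipartite _ _ (point-line inc) = inc
    from-bipartite _ _ (line-point inc) = inc

  Bipartite-≅ : ∀ {A A′ B B′ : Set} {I : A → B → Set} {I′ : A′ → B′ → Set}
    (φ : A ↔ A′) (ψ : B ↔ B′) → (∀ a b → I a b ⇔ I′ (Inverse.to φ a) (Inverse.to ψ b)) →
    Bipartite I ≅ Bipartite I′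
  Bipartite-≅ {I = I} {I′} φ ψ I⇔I′ = record
    { bijection = φ ⊎-cong ψ
    ; preserves = λ { _ _ (point-line i) → point-line (Equivalence.to (I⇔I′ _ _) i)
                    ; _ _ (line-point i) → line-point (Equivalence.to (I⇔I′ _ _) i) }
    ; reflects  = reflects′
    }
    where
    reflects′ : ∀ x y → let open Inverse (φ ⊎-cong ψ) in
                Bipartite I′ (to x) (to y) → Bipartite I x y
    reflects′ (inj₁ a) (inj₂ b) (point-line i) = point-line (Equivalence.from (I⇔I′ a b) i)
    reflects′ (inj₂ b) (inj₁ a) (line-point i) = line-point (Equivalence.from (I⇔I′ a b) i)

  data ΣAdj {t} (G : Fin t → Graph) : Rel (Σ (Fin t) (λ i → Fin (order (G i)))) 0ℓ where
    within : ∀ {i x y} → Adj (G i) x y → ΣAdj G (i , x) (i , y)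

  ΣAdj≅⋃ : ∀ {t} (G : Fin t → Graph) → ΣAdj G ≅ Adj (⋃ G)
  ΣAdj≅⋃ {zero} G = record
    { bijection = mk↔ₛ′ (λ { (() , _) }) (λ ()) (λ ()) (λ { (() , _) })
    ; preserves = λ { (() , _) }
    ; reflects  = λ { (() , _) }
    }
  ΣAdj≅⋃ {suc t} G = ≅-trans ΣAdj-suc
    (≅-trans (≅-refl ⊎-≅ ΣAdj≅⋃ (λ i → G (suc i))) (≅-sym (⊕-≅-Pointwise _ _)))
    where
    P = λ i → Fin (order (G i))
    to : Σ (Fin (suc t)) P → P zero ⊎ Σ (Fin t) (λ i → P (suc i))
    to (zero , x) = inj₁ x
    to (suc i , x) = inj₂ (i , x)
    from : P zero ⊎ Σ (Fin t) (λ i → P (suc i)) → Σ (Fin (suc t)) P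
    from (inj₁ x) = zero , x
    from (inj₂ (i , x)) = suc i , x
    ΣAdj-suc : ΣAdj G ≅ Pointwise (Adj (G zero)) (ΣAdj (λ i → G (suc i)))
    ΣAdj-suc = record
      { bijection = mk↔ₛ′ to from (λ { (inj₁ _) → refl ; (inj₂ _) → refl })
                                  (λ { (zero , _) → refl ; (suc _ , _) → refl })
      ; preserves = λ { (zero , _) _ (within a) → Pointwise.inj₁ a
                      ; (suc _ , _) _ (within a) → Pointwise.inj₂ (within a) }
      ; reflects  = λ { (zero , _) (zero , _) (Pointwise.inj₁ a) → within a
                      ; (suc _ , _) (suc _ , _) (Pointwise.inj₂ (within a)) → within a }
      }

  PointOrLine : ∀ {t} → (Fin t → ℕ) → Set
  PointOrLine {t} n = PolyElt t n ⊎ PolyElt t n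

  polygons↔cycles : ∀ {t} (n : Fin t → ℕ) → PointOrLine n ↔ Σ (Fin t) (λ i → Fin (2 * n i))
  polygons↔cycles {t} n = mk↔ₛ′ to from to∘from from∘to
    where
    place : ∀ {i} → Fin (n i) ⊎ Fin (n i) → Fin (2 * n i)
    place {i} = Inverse.to (interleave (n i))
    unplace : ∀ {i} → Fin (2 * n i) → Fin (n i) ⊎ Fin (n i)
    unplace {i} = Inverse.from (interleave (n i))
    to : PointOrLine n → Σ (Fin t) (λ i → Fin (2 * n i))
    to (inj₁ (i , b)) = i , place (inj₁ b)
    to (inj₂ (i , c)) = i , place (inj₂ c)
    tag : ∀ i → Fin (n i) ⊎ Fin (n i) → PointOrLine n
    tag i = Sum.map (i ,_) (i ,_)
    from : Σ (Fin t) (λ i → Fin (2 * n i)) → PointOrLine n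
    from (i , a) = tag i (unplace a)
    to∘tag : ∀ i x → to (tag i x) ≡ (i , place x)
    to∘tag i (inj₁ _) = refl
    to∘tag i (inj₂ _) = refl
    to∘from : ∀ y → to (from y) ≡ y
    to∘from (i , a) = trans (to∘tag i (unplace a)) (cong (i ,_) (Inverse.strictlyInverseˡ (interleave (n i)) a))
    from∘to : ∀ x → from (to x) ≡ x
    from∘to (inj₁ (i , b)) = cong (tag i) (Inverse.strictlyInverseʳ (interleave (n i)) (inj₁ b))
    from∘to (inj₂ (i , c)) = cong (tag i) (Inverse.strictlyInverseʳ (interleave (n i)) (inj₂ c))

  polygons≅cycles : ∀ {t} (n : Fin t → ℕ) → Bipartite (PolyInc n) ≅ ΣAdj (λ i → Cycle (2 * n i))
  polygons≅cycles {t} n = record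
    { bijection = polygons↔cycles n
    ; preserves = λ
        { _ _ (point-line (refl , inc)) → within (point-line⇒adj _ _ _ inc)
        ; _ _ (line-point (refl , inc)) → within (Sum.swap (point-line⇒adj _ _ _ inc)) }
    ; reflects  = reflects′
    }
    where
    place : ∀ {i} → Fin (n i) ⊎ Fin (n i) → Fin (2 * n i)
    place {i} = Inverse.to (interleave (n i))

    CycleAdj : ∀ i → Fin (2 * n i) → Fin (2 * n i) → Set
    CycleAdj i = Adj (Cycle (2 * n i))

    read : ∀ i {x y a b} → toℕ x ≡ a → toℕ y ≡ b → CycleAdj i x y → CycleAdjℕ (2 * n i) a b
    read i refl refl adj = adj

    write : ∀ i {x y a b} → toℕ x ≡ a → toℕ y ≡ b → CycleAdjℕ (2 * n i) a b → CycleAdj i x y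
    write i refl refl adj = adj

    point-line⇒adj : ∀ i b c → PolygonIncℕ (n i) (toℕ b) (toℕ c) → CycleAdj i (place (inj₁ b)) (place (inj₂ c))
    point-line⇒adj i b c inc =
      write i (toℕ-interleave-inj₁ b) (toℕ-interleave-inj₂ c) (polygonInc⇒cycleAdj (n i) _ _ inc)

    reflects′ : ∀ x y → let open Inverse (polygons↔cycles n) in
                ΣAdj (λ i → Cycle (2 * n i)) (to x) (to y) → Bipartite (PolyInc n) x y
    reflects′ (inj₁ (i , b)) (inj₂ (_ , c)) (within adj) =
      point-line (refl , cycleAdj⇒polygonInc (n i) (toℕ b) (toℕ c)
      (read i (toℕ-interleave-inj₁ b) (toℕ-interleave-inj₂ c) adj))
    reflects′ (inj₂ (i , c)) (inj₁ (_ , b)) (within adj) =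
      line-point (refl , cycleAdj⇒polygonInc (n i) (toℕ b) (toℕ c)
      (read i (toℕ-interleave-inj₁ b) (toℕ-interleave-inj₂ c) (Sum.swap adj)))
    reflects′ (inj₁ (i , b)) (inj₁ (_ , b′)) (within adj) = ⊥-elim (even-even-nonadjacent (n i) (toℕ b) (toℕ b′)
      (read i (toℕ-interleave-inj₁ b) (toℕ-interleave-inj₁ b′) adj))
    reflects′ (inj₂ (i , c)) (inj₂ (_ , c′)) (within adj) = ⊥-elim (odd-odd-nonadjacent (2 * n i) (toℕ c) (toℕ c′)
      (read i (toℕ-interleave-inj₂ c) (toℕ-interleave-inj₂ c′) adj))

  Levi≅⋃cycles : ∀ {v} (C : Config v) {t} {n : Fin t → ℕ} → IsoPolyUnion C t n →
                 Adj (Levi C) ≅ Adj (⋃ (λ i → Cycle (2 * n i)))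
  Levi≅⋃cycles C {n = n} iso = ≅-trans (Levi≅Bipartite C)
    (≅-trans (Bipartite-≅ onPoints onLines incidence)
    (≅-trans (polygons≅cycles n) (ΣAdj≅⋃ _)))
    where open IsoPolyUnion iso

module CountTwo where

  open import Data.Nat using (zero; suc)
  open import Data.Nat.Properties using (suc-injective)
  open import Data.Fin using (Fin; zero; suc)
  open import Data.Fin.Properties using (_≟_) renaming (suc-injective to Fin-suc-injective)
  open import Data.Bool using (Bool; true; false)
  open import Data.Product using (Σ; _×_; _,_)
  open import Data.Sum as Sum using (_⊎_; inj₁; inj₂)
  open import Data.Empty using (⊥-elim)
  open import Relation.Nullary using (yes; no)
  open import Relation.Binary.PropositionalEquality

  private
    true≢false : true ≢ false
    true≢false ()

  count≡0⇒none : ∀ {m} (p : Fin m → Bool) → count p ≡ 0 → ∀ z → p z ≢ true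
  count≡0⇒none {suc m} p c z pz with p zero in p0
  count≡0⇒none {suc m} p () z pz | true
  count≡0⇒none {suc m} p c zero pz | false = true≢false (trans (sym pz) p0)
  count≡0⇒none {suc m} p c (suc z) pz | false = count≡0⇒none (λ i → p (suc i)) c z pz

  count≡1⇒unique : ∀ {m} (p : Fin m → Bool) → count p ≡ 1 →
                   Σ (Fin m) λ x → p x ≡ true × (∀ z → p z ≡ true → z ≡ x)
  count≡1⇒unique {zero} p ()
  count≡1⇒unique {suc m} p c with p zero in p0
  ... | true = zero , p0 , λ
        { zero _ → refl
        ; (suc z) pz → ⊥-elim (count≡0⇒none (λ i → p (suc i)) (suc-injective c) z pz) }
  ... | false with count≡1⇒unique (λ i → p (suc i)) c
  ...   | x , px , unique = suc x , px , λ
          { zero pz → ⊥-elim (true≢false (trans (sym pz) p0))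
          ; (suc z) pz → cong suc (unique z pz) }

  record Pair {m} (p : Fin m → Bool) : Set where
    field
      fst snd  : Fin m
      fst≢snd  : fst ≢ snd
      p-fst    : p fst ≡ true
      p-snd    : p snd ≡ true
      covers   : ∀ z → p z ≡ true → z ≡ fst ⊎ z ≡ snd

  count≡2⇒pair : ∀ {m} (p : Fin m → Bool) → count p ≡ 2 → Pair p
  count≡2⇒pair {zero} p ()
  count≡2⇒pair {suc m} p c with p zero in p0
  ... | true with count≡1⇒unique (λ i → p (suc i)) (suc-injective c)
  ...   | x , px , unique = record
          { fst = zero ; snd = suc x ; fst≢snd = λ () ; p-fst = p0 ; p-snd = px
          ; covers = λ { zero _ → inj₁ refl ; (suc z) pz → inj₂ (cong suc (unique z pz)) } }
  count≡2⇒pair {suc m} p c | false = record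
    { fst = suc fst ; snd = suc snd ; fst≢snd = λ e → fst≢snd (Fin-suc-injective e)
    ; p-fst = p-fst ; p-snd = p-snd
    ; covers = λ { zero pz → ⊥-elim (true≢false (trans (sym pz) p0))
                 ; (suc z) pz → Sum.map (cong suc) (cong suc) (covers z pz) } }
    where open Pair (count≡2⇒pair (λ i → p (suc i)) c)

  module Other {m} {p : Fin m → Bool} (pair : Pair p) where

    open Pair pair

    other : Fin m → Fin m
    other z with z ≟ fst
    ... | yes _ = snd
    ... | no _  = fst

    other-holds : ∀ z → p (other z) ≡ true
    other-holds z with z ≟ fst
    ... | yes _ = p-snd
    ... | no _  = p-fst

    other-≢ : ∀ z → other z ≢ z
    other-≢ z with z ≟ fst
    ... | yes z≡fst = λ snd≡z → fst≢snd (trans (sym z≡fst) (sym snd≡z))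
    ... | no z≢fst  = λ fst≡z → z≢fst (sym fst≡z)

    other-covers : ∀ z w → p z ≡ true → p w ≡ true → w ≡ z ⊎ w ≡ other z
    other-covers z w pz pw with z ≟ fst
    ... | yes z≡fst = Sum.map₁ (λ w≡fst → trans w≡fst (sym z≡fst)) (covers w pw)
    ... | no z≢fst with covers z pz
    ...   | inj₁ z≡fst = ⊥-elim (z≢fst z≡fst)
    ...   | inj₂ z≡snd = Sum.swap (Sum.map₂ (λ w≡snd → trans w≡snd (sym z≡snd)) (covers w pw))

    distinct-cover : ∀ z₁ z₂ w → p z₁ ≡ true → p z₂ ≡ true → z₁ ≢ z₂ → p w ≡ true → w ≡ z₁ ⊎ w ≡ z₂
    distinct-cover z₁ z₂ w p₁ p₂ z₁≢z₂ pw with other-covers z₁ z₂ p₁ p₂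
    ... | inj₁ z₂≡z₁ = ⊥-elim (z₁≢z₂ (sym z₂≡z₁))
    ... | inj₂ z₂≡other = Sum.map₂ (λ w≡other → trans w≡other (sym z₂≡other)) (other-covers z₁ w p₁ pw)

module ClosedWalk where

  open import Data.Nat using (ℕ; zero; suc; pred; _+_; _<_; _≤_; s≤s; z≤n; >-nonZero)
  open import Data.Nat.Properties
    using (n<1+n; <-trans; ≤-trans; <-irrefl; m<1+n⇒m<n∨m≡n; +-suc; +-comm; suc-pred)
  open import Data.Fin using (Fin; toℕ; fromℕ<)
  open import Data.Fin.Properties using (_≟_; any?; pigeonhole; toℕ<n; toℕ-injective; toℕ-fromℕ<)
  open import Data.Bool using (true)
  open import Data.Product using (Σ; _×_; _,_; proj₁; proj₂)
  open import Data.Sum using (_⊎_; inj₁; inj₂)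
  open import Data.Empty using (⊥; ⊥-elim)
  open import Relation.Nullary using (¬_; Dec; yes; no)
  open import Relation.Binary.PropositionalEquality
  open CountTwo
  open CyclicIncidence using (Nextℕ; PolygonIncℕ)

  module Walk {v} (C : Config v) (V : IsV2 C) (P₀ : Fin v) where

    open Config C
    open IsV2 V

    linesThrough : ∀ P → Pair (λ ℓ → Inc P ℓ)
    linesThrough P = count≡2⇒pair _ (point-2-lines P)

    module OnLine (ℓ : Fin v) = Other (count≡2⇒pair (λ P → Inc P ℓ) (line-2-points ℓ))
    module Through (P : Fin v) = Other (linesThrough P)

    step : ℕ → Fin v × Fin v
    step zero = P₀ , Pair.fst (linesThrough P₀)
    step (suc k) = let Q = OnLine.other (proj₂ (step k)) (proj₁ (step k)) in Q , Through.other Q (proj₂ (step k))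

    point line : ℕ → Fin v
    point k = proj₁ (step k)
    line k = proj₂ (step k)

    on-line : ∀ k → Inc (point k) (line k) ≡ true
    on-line zero = Pair.p-fst (linesThrough P₀)
    on-line (suc k) = Through.other-holds (point (suc k)) (line k)

    next-on-line : ∀ k → Inc (point (suc k)) (line k) ≡ true
    next-on-line k = OnLine.other-holds (line k) (point k)

    point-moves : ∀ k → point (suc k) ≢ point k
    point-moves k = OnLine.other-≢ (line k) (point k)

    line-moves : ∀ k → line (suc k) ≢ line k
    line-moves k = Through.other-≢ (point (suc k)) (line k)

    points-on : ∀ k Q → Inc Q (line k) ≡ true → Q ≡ point k ⊎ Q ≡ point (suc k)
    points-on k Q = OnLine.other-covers (line k) (point k) Q (on-line k)

    lines-through-next : ∀ k ℓ → Inc (point (suc k)) ℓ ≡ true → ℓ ≡ line k ⊎ ℓ ≡ line (suc k)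
    lines-through-next k ℓ = Through.other-covers (point (suc k)) (line k) ℓ (next-on-line k)

    DistinctBelow : ℕ → Set
    DistinctBelow k = ∀ a b → a < k → b < k → point a ≡ point b → a ≡ b

    Revisits : ℕ → Set
    Revisits k = Σ ℕ λ i → i < k × point i ≡ point k

    revisits? : ∀ k → Dec (Revisits k)
    revisits? k with any? (λ (i : Fin k) → point (toℕ i) ≟ point k)
    ... | yes (i , e) = yes (toℕ i , toℕ<n i , e)
    ... | no ¬r = no λ (i , i<k , e) → ¬r (fromℕ< i<k , subst (λ j → point j ≡ point k) (sym (toℕ-fromℕ< i<k)) e)

    distinctBelow-suc : ∀ k → DistinctBelow k → ¬ Revisits k → DistinctBelow (suc k)
    distinctBelow-suc k d ¬r a b a<1+k b<1+k e with m<1+n⇒m<n∨m≡n a<1+k | m<1+n⇒m<n∨m≡n b<1+k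
    ... | inj₁ a<k  | inj₁ b<k  = d a b a<k b<k e
    ... | inj₂ refl | inj₂ refl = refl
    ... | inj₁ a<k  | inj₂ refl = ⊥-elim (¬r (a , a<k , e))
    ... | inj₂ refl | inj₁ b<k  = ⊥-elim (¬r (b , b<k , sym e))

    ¬distinctBelow-1+v : ¬ DistinctBelow (suc v)
    ¬distinctBelow-1+v d with pigeonhole (n<1+n v) (λ (i : Fin (suc v)) → point (toℕ i))
    ... | i , j , i<j , e = <-irrefl (cong toℕ (toℕ-injective (d _ _ (toℕ<n i) (toℕ<n j) e))) i<j

    record FirstReturn : Set where
      field
        length   : ℕ
        distinct : DistinctBelow length
        earlier  : ℕ
        earlier<length : earlier < length
        revisit  : point earlier ≡ point length

    -- Scan k = 1, 2, …; by pigeonhole a revisit occurs before the fuel runs out.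
    firstReturn-from : ∀ fuel k → fuel + k ≡ suc v → DistinctBelow k → FirstReturn
    firstReturn-from zero k e d = ⊥-elim (¬distinctBelow-1+v (subst DistinctBelow e d))
    firstReturn-from (suc fuel) k e d with revisits? k
    ... | yes (i , i<k , r) =
      record { length = k ; distinct = d ; earlier = i ; earlier<length = i<k ; revisit = r }
    ... | no ¬r = firstReturn-from fuel (suc k) (trans (+-suc fuel k) e) (distinctBelow-suc k d ¬r)

    firstReturn : FirstReturn
    firstReturn = firstReturn-from v 1 (+-comm v 1) λ
      { zero zero _ _ _ → refl
      ; (suc _) _ (s≤s ()) _ _
      ; zero (suc _) _ (s≤s ()) _ }

    open FirstReturn firstReturn public using (length; distinct)

    -- A first revisit of an interior point would put three lines through it.
    first-return-to-start : ∀ i j → DistinctBelow j → i < j → point i ≡ point j → i ≡ 0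
    first-return-to-start zero j _ _ _ = refl
    first-return-to-start (suc i′) (suc j′) d i<j e =
      ⊥-elim (by-line (lines-through-next i′ (line j′) i-on-j′))
      where
      i = suc i′
      j = suc j′
      j′<j = n<1+n j′
      i-on-j′ : Inc (point i) (line j′) ≡ true
      i-on-j′ = subst (λ P → Inc P (line j′) ≡ true) (sym e) (next-on-line j′)
      i′<j = <-trans (n<1+n i′) i<j
      ¬j′≡i : point j′ ≢ point i
      ¬j′≡i j′≡i = point-moves j′ (trans (sym e) (sym j′≡i))
      j′-on : ∀ {ℓ} → line j′ ≡ ℓ → Inc (point j′) ℓ ≡ true
      j′-on refl = on-line j′
      by-line : line j′ ≡ line i′ ⊎ line j′ ≡ line i → ⊥
      by-line (inj₁ j′≡i′) with points-on i′ (point j′) (j′-on j′≡i′)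
      ... | inj₁ p = <-irrefl (cong suc (sym (d j′ i′ j′<j i′<j p))) i<j
      ... | inj₂ p = ¬j′≡i p
      by-line (inj₂ j′≡i) with points-on i (point j′) (j′-on j′≡i)
      ... | inj₁ p = ¬j′≡i p
      ... | inj₂ p with m<1+n⇒m<n∨m≡n (s≤s i<j)
      ...   | inj₂ 1+i≡j = point-moves j′ (sym (trans p (cong point 1+i≡j)))
      ...   | inj₁ 1+i<j = line-moves i (trans (sym (cong line (d j′ (suc i) j′<j 1+i<j p))) j′≡i)

    closes : point length ≡ point 0
    closes = sym (subst (λ a → point a ≡ point length)
      (first-return-to-start earlier length distinct earlier<length revisit) revisit)
      where open FirstReturn firstReturn using (earlier; earlier<length; revisit)

    -- Length 1 would make consecutive points equal; length 2 would give two points two common lines.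
    3≤length : 3 ≤ length
    3≤length = at-least-3 length (≤-trans (s≤s z≤n) earlier<length) closes
      where
      open FirstReturn firstReturn using (earlier<length)
      at-least-3 : ∀ m → 0 < m → point m ≡ point 0 → 3 ≤ m
      at-least-3 1 _ c = ⊥-elim (point-moves 0 c)
      at-least-3 2 _ c = ⊥-elim (line-moves 0 (sym (points-≤1-line (point 0) (point 1)
        (λ e → point-moves 0 (sym e)) (line 0) (line 1) (on-line 0) (next-on-line 0)
        (subst (λ P → Inc P (line 1) ≡ true) c (next-on-line 1)) (on-line 1))))
      at-least-3 (suc (suc (suc _))) _ _ = s≤s (s≤s (s≤s z≤n))

    0<length : 0 < length
    0<length = ≤-trans (s≤s z≤n) 3≤length

    next-index : ∀ a → a < length → Σ ℕ λ a′ → a′ < length × Nextℕ length a′ a × point (suc a) ≡ point a′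
    next-index a a<n with m<1+n⇒m<n∨m≡n (s≤s a<n)
    ... | inj₁ 1+a<n = suc a , 1+a<n , inj₁ refl , refl
    ... | inj₂ 1+a≡n = 0 , 0<length , inj₂ (refl , 1+a≡n) , trans (cong point 1+a≡n) closes

    incidence⇒ : ∀ a b → a < length → b < length → Inc (point a) (line b) ≡ true → PolygonIncℕ length a b
    incidence⇒ a b a<n b<n inc with points-on b (point a) inc
    ... | inj₁ a≡b = inj₁ (distinct a b a<n b<n a≡b)
    ... | inj₂ a≡1+b with next-index b b<n
    ...   | b′ , b′<n , next , 1+b≡b′ =
            inj₂ (subst (λ c → Nextℕ length c b) (sym (distinct a b′ a<n b′<n (trans a≡1+b 1+b≡b′))) next)

    incidence⇐ : ∀ a b → PolygonIncℕ length a b → Inc (point a) (line b) ≡ true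
    incidence⇐ a .a (inj₁ refl) = on-line a
    incidence⇐ .(suc b) b (inj₂ (inj₁ refl)) = next-on-line b
    incidence⇐ .0 b (inj₂ (inj₂ (refl , 1+b≡n))) =
      subst (λ P → Inc P (line b) ≡ true) (trans (cong point 1+b≡n) closes) (next-on-line b)

    line-index : ∀ a b → a < length → b < length → line a ≡ line b → b ≡ a ⊎ (suc a ≡ length × b ≡ 0)
    line-index a b a<n b<n e
      with incidence⇒ b a b<n a<n (subst (λ ℓ → Inc (point b) ℓ ≡ true) (sym e) (on-line b))
    ... | inj₁ b≡a = inj₁ b≡a
    ... | inj₂ (inj₁ refl) = ⊥-elim (line-moves a (sym e))
    ... | inj₂ (inj₂ (b≡0 , 1+a≡n)) = inj₂ (1+a≡n , b≡0)

    lines-distinct : ∀ a b → a < length → b < length → line a ≡ line b → a ≡ b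
    lines-distinct a b a<n b<n e with line-index a b a<n b<n e | line-index b a b<n a<n (sym e)
    ... | inj₁ b≡a | _ = sym b≡a
    ... | inj₂ _ | inj₁ a≡b = a≡b
    ... | inj₂ (1+a≡n , refl) | inj₂ (_ , refl) = ⊥-elim (<-irrefl 1+a≡n (≤-trans (s≤s (s≤s z≤n)) 3≤length))

    points-on-cycle : ∀ b Q → b < length → Inc Q (line b) ≡ true → Σ ℕ λ a → a < length × Q ≡ point a
    points-on-cycle b Q b<n inc with points-on b Q inc
    ... | inj₁ Q≡b = b , b<n , Q≡b
    ... | inj₂ Q≡1+b with next-index b b<n
    ...   | b′ , b′<n , _ , 1+b≡b′ = b′ , b′<n , trans Q≡1+b 1+b≡b′

    last : ℕ
    last = pred length

    1+last≡length : suc last ≡ length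
    1+last≡length = suc-pred length {{>-nonZero 0<length}}

    last<length : last < length
    last<length = subst (last <_) 1+last≡length (n<1+n last)

    lines-through-start : ∀ ℓ → Inc P₀ ℓ ≡ true → ℓ ≡ line 0 ⊎ ℓ ≡ line last
    lines-through-start ℓ = Through.distinct-cover P₀ (line 0) (line last) ℓ (on-line 0) last-through-start 0≢last
      where
      last-through-start : Inc P₀ (line last) ≡ true
      last-through-start =
        subst (λ P → Inc P (line last) ≡ true) (trans (cong point 1+last≡length) closes) (next-on-line last)
      0≢last : line 0 ≢ line last
      0≢last e = <-irrefl (trans (cong suc (lines-distinct 0 last 0<length last<length e)) 1+last≡length)
                          (≤-trans (s≤s (s≤s z≤n)) 3≤length)

    lines-through-cycle : ∀ a ℓ → a < length → Inc (point a) ℓ ≡ true → Σ ℕ λ b → b < length × ℓ ≡ line b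
    lines-through-cycle (suc a) ℓ 1+a<n inc with lines-through-next a ℓ inc
    ... | inj₁ ℓ≡a = a , <-trans (n<1+n a) 1+a<n , ℓ≡a
    ... | inj₂ ℓ≡1+a = suc a , 1+a<n , ℓ≡1+a
    lines-through-cycle zero ℓ _ inc with lines-through-start ℓ inc
    ... | inj₁ ℓ≡0 = 0 , 0<length , ℓ≡0
    ... | inj₂ ℓ≡last = last , last<length , ℓ≡last

module Decomposition where

  open import Data.Nat using (ℕ; zero; suc; _+_; _<_; s≤s)
  open import Data.Nat.Properties using (+-suc; +-identityʳ; m≤n+m; m<1+n⇒m<n∨m≡n)
  open import Data.Fin using (Fin; zero; suc; toℕ; fromℕ<)
  open import Data.Fin.Properties using (_≟_; any?; toℕ<n; toℕ-injective; toℕ-fromℕ<)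
    renaming (suc-injective to Fin-suc-injective)
  open import Data.Bool using (Bool; true; false; if_then_else_)
  import Data.Bool.Properties as Bool
  open import Data.Product using (Σ; _,_; proj₁)
  open import Data.Sum as Sum using (_⊎_; inj₁; inj₂)
  open import Data.Sum.Function.Propositional using (_⊎-cong_)
  open import Data.Vec.Functional using (_∷_)
  open import Data.Empty using (⊥-elim)
  open import Function.Base using (_∘′_)
  open import Function.Bundles using (_↔_; _⇔_; Inverse; Equivalence; mk↔ₛ′; mk⇔)
  open import Function.Properties.Inverse using (↔-refl; ↔-sym; ↔-trans)
  open import Relation.Nullary using (¬_; Dec; yes; no)
  open import Relation.Nullary.Decidable using (⌊_⌋)
  open import Relation.Binary.PropositionalEquality
  open import Axiom.UniquenessOfIdentityProofs using (module Decidable⇒UIP)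
  open ClosedWalk

  private
    true≢false : true ≢ false
    true≢false ()

  Live : ∀ {v} → (Fin v → Bool) → Set
  Live {v} S = Σ (Fin v) λ P → S P ≡ true

  live-≡ : ∀ {v} {S : Fin v → Bool} {P Q s s′} → P ≡ Q → _≡_ {A = Live S} (P , s) (Q , s′)
  live-≡ {s = s} {s′} refl = cong (_ ,_) (Decidable⇒UIP.≡-irrelevant Bool._≟_ s s′)

  module RemoveImage {v} (R : Fin v → Bool) {n} (X : Fin n → Fin v)
    (X-injective : ∀ a b → X a ≡ X b → a ≡ b) (X-live : ∀ a → R (X a) ≡ true) where

    InImage : Fin v → Set
    InImage P = Σ (Fin n) λ a → X a ≡ P

    inImage? : ∀ P → Dec (InImage P)
    inImage? P = any? (λ a → X a ≟ P)

    rest : Fin v → Bool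
    rest P = if ⌊ inImage? P ⌋ then false else R P

    rest⇒live : ∀ P → rest P ≡ true → R P ≡ true
    rest⇒live P with inImage? P
    ... | yes _ = λ ()
    ... | no _  = λ r → r

    rest-dead : ∀ P → R P ≡ false → rest P ≡ false
    rest-dead P r with inImage? P
    ... | yes _ = refl
    ... | no _  = r

    rest-on-image : ∀ P → InImage P → rest P ≡ false
    rest-on-image P ∈ with inImage? P
    ... | yes _ = refl
    ... | no ∉  = ⊥-elim (∉ ∈)

    rest-off-image : ∀ P → ¬ InImage P → R P ≡ true → rest P ≡ true
    rest-off-image P ∉ r with inImage? P
    ... | yes ∈ = ⊥-elim (∉ ∈)
    ... | no _  = r

    classify : ∀ P → R P ≡ true → Dec (InImage P) → Fin n ⊎ Live rest
    classify P r (yes (a , _)) = inj₁ a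
    classify P r (no ∉)        = inj₂ (P , rest-off-image P ∉ r)

    unclassify : Fin n ⊎ Live rest → Live R
    unclassify (inj₁ a)       = X a , X-live a
    unclassify (inj₂ (P , r)) = P , rest⇒live P r

    unclassify∘classify : ∀ P r d → unclassify (classify P r d) ≡ (P , r)
    unclassify∘classify P r (yes (a , Xa≡P)) = live-≡ Xa≡P
    unclassify∘classify P r (no _)           = live-≡ refl

    classify-image : ∀ a r d → classify (X a) r d ≡ inj₁ a
    classify-image a r (yes (a′ , Xa′≡Xa)) = cong inj₁ (X-injective a′ a Xa′≡Xa)
    classify-image a r (no ∉)               = ⊥-elim (∉ (a , refl))

    classify-rest : ∀ P (r : rest P ≡ true) d → classify P (rest⇒live P r) d ≡ inj₂ (P , r)
    classify-rest P r (yes ∈) = ⊥-elim (true≢false (trans (sym r) (rest-on-image P ∈)))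
    classify-rest P r (no _)  = cong inj₂ (live-≡ refl)

    split : Live R ↔ (Fin n ⊎ Live rest)
    split = mk↔ₛ′ (λ (P , r) → classify P r (inImage? P)) unclassify
      (λ { (inj₁ a) → classify-image a _ (inImage? (X a))
         ; (inj₂ (P , r)) → classify-rest P r (inImage? P) })
      (λ (P , r) → unclassify∘classify P r (inImage? P))

  ClosedUnderIncidence : ∀ {v} → Config v → (Fin v → Bool) → (Fin v → Bool) → Set
  ClosedUnderIncidence {v} C S T = ∀ P ℓ → Config.Inc C P ℓ ≡ true → S P ≡ T ℓ

  record PolygonDecomposition {v} (C : Config v) (S T : Fin v → Bool) : Set where
    field
      t         : ℕ
      n         : Fin t → ℕ
      n>2       : ∀ i → 2 < n i
      onPoints  : Live S ↔ PolyElt t n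
      onLines   : Live T ↔ PolyElt t n
      incidence : ∀ p ℓ → (Config.Inc C (proj₁ p) (proj₁ ℓ) ≡ true) ⇔
                          PolyInc n (Inverse.to onPoints p) (Inverse.to onLines ℓ)

  nothing-live : ∀ {v} (C : Config v) (V : IsV2 C) {S T} → ClosedUnderIncidence C S T →
                 (∀ P → S P ≡ false) → PolygonDecomposition C S T
  nothing-live C V {S} {T} closed dead = record
    { t = 0 ; n = λ () ; n>2 = λ ()
    ; onPoints  = mk↔ₛ′ (λ (P , s) → ⊥-elim (no-point P s)) (λ ()) (λ ()) (λ (P , s) → ⊥-elim (no-point P s))
    ; onLines   = mk↔ₛ′ (λ (ℓ , s) → ⊥-elim (no-line ℓ s)) (λ ()) (λ ()) (λ (ℓ , s) → ⊥-elim (no-line ℓ s))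
    ; incidence = λ (P , s) _ → ⊥-elim (no-point P s)
    }
    where
    no-point : ∀ P → S P ≢ true
    no-point P s = true≢false (trans (sym s) (dead P))
    no-line : ∀ ℓ → T ℓ ≢ true
    no-line ℓ s = no-point P (trans (closed P ℓ p-fst) s)
      where open CountTwo.Pair (CountTwo.count≡2⇒pair (λ P → Config.Inc C P ℓ) (IsV2.line-2-points V ℓ))
              renaming (fst to P)

  PolyElt-∷ : ∀ {t} k (n : Fin t → ℕ) → PolyElt (suc t) (k ∷ n) ↔ (Fin k ⊎ PolyElt t n)
  PolyElt-∷ k n = mk↔ₛ′
    (λ { (zero , a) → inj₁ a ; (suc i , a) → inj₂ (i , a) })
    (λ { (inj₁ a) → zero , a ; (inj₂ (i , a)) → suc i , a })
    (λ { (inj₁ _) → refl ; (inj₂ _) → refl })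
    (λ { (zero , _) → refl ; (suc _ , _) → refl })

  module Peel {v} (C : Config v) (V : IsV2 C) {S T : Fin v → Bool}
    (closed : ClosedUnderIncidence C S T) (P₀ : Fin v) (S-P₀ : S P₀ ≡ true) where

    open Config C
    open Walk C V P₀

    point-live : ∀ k → S (point k) ≡ true
    point-live zero = S-P₀
    point-live (suc k) = trans (closed _ _ (next-on-line k)) (trans (sym (closed _ _ (on-line k))) (point-live k))

    line-live : ∀ k → T (line k) ≡ true
    line-live k = trans (sym (closed _ _ (on-line k))) (point-live k)

    module Points = RemoveImage S (λ (a : Fin length) → point (toℕ a))
      (λ a b e → toℕ-injective (distinct _ _ (toℕ<n a) (toℕ<n b) e)) (λ a → point-live (toℕ a))
    module Lines = RemoveImage T (λ (b : Fin length) → line (toℕ b))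
      (λ a b e → toℕ-injective (lines-distinct _ _ (toℕ<n a) (toℕ<n b) e)) (λ b → line-live (toℕ b))

    S′ T′ : Fin v → Bool
    S′ = Points.rest
    T′ = Lines.rest

    S′-P₀ : S′ P₀ ≡ false
    S′-P₀ = Points.rest-on-image P₀ (fromℕ< 0<length , cong point (toℕ-fromℕ< 0<length))

    line-on-cycle : ∀ {P ℓ} → Points.InImage P → Inc P ℓ ≡ true → Lines.InImage ℓ
    line-on-cycle {ℓ = ℓ} (a , refl) inc with lines-through-cycle (toℕ a) ℓ (toℕ<n a) inc
    ... | b , b<n , ℓ≡b = fromℕ< b<n , trans (cong line (toℕ-fromℕ< b<n)) (sym ℓ≡b)

    point-on-cycle : ∀ {P ℓ} → Lines.InImage ℓ → Inc P ℓ ≡ true → Points.InImage P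
    point-on-cycle {P} (b , refl) inc with points-on-cycle (toℕ b) P (toℕ<n b) inc
    ... | a , a<n , P≡a = fromℕ< a<n , trans (cong point (toℕ-fromℕ< a<n)) (sym P≡a)

    closed′ : ClosedUnderIncidence C S′ T′
    closed′ P ℓ inc with Points.inImage? P | Lines.inImage? ℓ
    ... | yes _ | yes _ = refl
    ... | no _  | no _  = closed P ℓ inc
    ... | yes p | no ¬l = ⊥-elim (¬l (line-on-cycle p inc))
    ... | no ¬p | yes l = ⊥-elim (¬p (point-on-cycle l inc))

    extend : PolygonDecomposition C S′ T′ → PolygonDecomposition C S T
    extend D = record
      { t = suc D.t ; n = n ; n>2 = λ { zero → 3≤length ; (suc i) → D.n>2 i }
      ; onPoints  = ↔-trans Points.split (↔-trans (↔-refl ⊎-cong D.onPoints) (↔-sym (PolyElt-∷ length D.n)))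
      ; onLines   = ↔-trans Lines.split (↔-trans (↔-refl ⊎-cong D.onLines) (↔-sym (PolyElt-∷ length D.n)))
      ; incidence = λ (P , s) (ℓ , s′) → incidence′ P s ℓ s′ (Points.inImage? P) (Lines.inImage? ℓ)
      }
      where
      module D = PolygonDecomposition D
      n = length ∷ D.n
      placeP : Fin length ⊎ Live S′ → PolyElt (suc D.t) n
      placeP = Inverse.from (PolyElt-∷ length D.n) ∘′ Sum.map (λ a → a) (Inverse.to D.onPoints)
      placeL : Fin length ⊎ Live T′ → PolyElt (suc D.t) n
      placeL = Inverse.from (PolyElt-∷ length D.n) ∘′ Sum.map (λ a → a) (Inverse.to D.onLines)
      incidence′ : ∀ P s ℓ s′ dP dℓ → (Inc P ℓ ≡ true) ⇔
                   PolyInc n (placeP (Points.classify P s dP)) (placeL (Lines.classify ℓ s′ dℓ))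
      incidence′ P s ℓ s′ (yes (a , refl)) (yes (b , refl)) =
        mk⇔ (λ inc → refl , incidence⇒ _ _ (toℕ<n a) (toℕ<n b) inc) (λ (_ , inc) → incidence⇐ _ _ inc)
      incidence′ P s ℓ s′ (no ¬p) (no ¬l) = mk⇔
        (λ inc → let (i≡j , inc′) = Equivalence.to (D.incidence (P , _) (ℓ , _)) inc in cong suc i≡j , inc′)
        (λ (i≡j , inc′) → Equivalence.from (D.incidence (P , _) (ℓ , _)) (Fin-suc-injective i≡j , inc′))
      incidence′ P s ℓ s′ (yes p) (no ¬l) = mk⇔ (λ inc → ⊥-elim (¬l (line-on-cycle p inc))) (λ ())
      incidence′ P s ℓ s′ (no ¬p) (yes l) = mk⇔ (λ inc → ⊥-elim (¬p (point-on-cycle l inc))) (λ ())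

  kth : ∀ {v} fuel k → suc fuel + k ≡ v → Fin v
  kth fuel k e = fromℕ< (subst (k <_) e (s≤s (m≤n+m k fuel)))

  toℕ-kth : ∀ {v} fuel k (e : suc fuel + k ≡ v) → toℕ (kth fuel k e) ≡ k
  toℕ-kth fuel k e = toℕ-fromℕ< _

  -- Scan the points in order; each live point found starts a polygon, which is then removed.
  module _ {v} (C : Config v) (V : IsV2 C) where

    dead-below-suc : ∀ {S : Fin v → Bool} {k} (P : Fin v) → toℕ P ≡ k → S P ≡ false →
      (∀ Q → toℕ Q < k → S Q ≡ false) → ∀ Q → toℕ Q < suc k → S Q ≡ false
    dead-below-suc {S} P P≡k SP dead-below Q Q<1+k with m<1+n⇒m<n∨m≡n Q<1+k
    ... | inj₁ Q<k = dead-below Q Q<k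
    ... | inj₂ Q≡k = trans (cong S (toℕ-injective (trans Q≡k (sym P≡k)))) SP

    decompose-from : ∀ fuel k → fuel + k ≡ v → ∀ {S T} → ClosedUnderIncidence C S T →
                     (∀ P → toℕ P < k → S P ≡ false) → PolygonDecomposition C S T
    decompose-from zero k e closed dead-below =
      nothing-live C V closed (λ P → dead-below P (subst (toℕ P <_) (sym e) (toℕ<n P)))
    decompose-from (suc fuel) k e {S} closed dead-below with S (kth fuel k e) in S-kth
    ... | false = decompose-from fuel (suc k) (trans (+-suc fuel k) e) closed
                    (dead-below-suc (kth fuel k e) (toℕ-kth fuel k e) S-kth dead-below)
    ... | true = Peeled.extend (decompose-from fuel (suc k) (trans (+-suc fuel k) e) Peeled.closed′
                   (dead-below-suc (kth fuel k e) (toℕ-kth fuel k e) Peeled.S′-P₀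
                     λ Q Q<k → Peeled.Points.rest-dead Q (dead-below Q Q<k)))
      where module Peeled = Peel C V closed (kth fuel k e) S-kth

    decomposition : PolygonDecomposition C (λ _ → true) (λ _ → true)
    decomposition = decompose-from v 0 (+-identityʳ v) (λ _ _ _ → refl) (λ _ ())

  isoPolyUnion : ∀ {v} {C : Config v} (D : PolygonDecomposition C (λ _ → true) (λ _ → true)) →
                 let open PolygonDecomposition D in IsoPolyUnion C t n
  isoPolyUnion D = record
    { onPoints  = ↔-trans everything-live onPoints
    ; onLines   = ↔-trans everything-live onLines
    ; incidence = λ P ℓ → incidence (P , refl) (ℓ , refl)
    }
    where
    open PolygonDecomposition D
    everything-live : ∀ {v} → Fin v ↔ Live {v} (λ _ → true)
    everything-live = mk↔ₛ′ (λ P → P , refl) proj₁ (λ { (_ , refl) → refl }) (λ _ → refl)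

open import Level using (Level)
open import Data.Nat using (ℕ; _<_; _*_)
open import Data.Fin using (Fin)
open import Data.Product using (Σ; _×_; _,_)
open Decomposition using (decomposition; isoPolyUnion; module PolygonDecomposition)
open RelationIsomorphism using (≅-sym)
open WellCoveredDimension using (wcdim-≅; wcdim-⋃)
open EvenCycles using (cycle-hasMaximalIndependentSet)
open LeviOfPolygons using (Levi≅⋃cycles)

lemma3p1 : ∀ {c ℓ : Level} {v : ℕ} (C : Config v) → IsV2 C →
    Σ ℕ (λ t → Σ (Fin t → ℕ) (λ n →
    (∀ i → 2 < n i) ×
    IsoPolyUnion C t n ×
    ((F : Field c ℓ) (d : Fin t → ℕ) →
    (∀ i → WCDim F (Cycle (2 * n i)) (d i)) →
    WCDim F (Levi C) (sumℕ d))))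
lemma3p1 C V = t , n , n>2 , iso , λ F d dims →
  wcdim-≅ F (≅-sym (Levi≅⋃cycles C iso))
    (wcdim-⋃ F _ d (λ i → cycle-hasMaximalIndependentSet (n i)) dims)
  where
  D = decomposition C V
  open PolygonDecomposition D using (t; n; n>2)
  iso = isoPolyUnion D
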